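{- Let $G=(V,E,w)$ be a graph with non-negative node weights, let $\vec y$ be a fractional $w$-matching of $G$ with slacks $s(v)$, let $X\subseteq\{v\in V:s(v)>0\}$ and $F\subseteq\{e\in E:y_e>0\}$, and define $w'(v):=w(v)-s(v)-y(E(v)\cap F)$ for $v\in X$ and $w'(v):=w(v)-y(E(v)\cap F)$ for $v\notin X$. Let $S^*$ be a minimum weight vertex cover of $G$ w.r.t. $w$, and assume that for some $\alpha\geq1$, $S$ is an $\alpha$-approximate minimum weighted vertex cover of $G$ w.r.t. the weights $w'$. Then $$w(S)\leq \alpha\cdot w(S^*)+s(X)+y(F),\qquad\text{where } s(X):=\sum_{v\in X}s(v).$$
   Context: A fractional $w$-matching is an assignment $y_e\ge0$ to edges with $\sum_{e\in E(v)}y_e\le w(v)$ for every node $v$, where $E(v)$ is the set of edges incident to $v$; $y(F'):=\sum_{e\in F'}y_e$. The slack of $v$ is $s(v)=w(v)-\sum_{e\in E(v)}y_e$. A vertex cover is a set of nodes meeting every edge; $w(S)=\sum_{v\in S}w(v)$.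
   Formalization: The node weights, the values $y_e$ of the fractional $w$-matching and the factor $\alpha$ are rational. -}

module Defs where

open import Data.Nat using (ℕ; zero; suc)
open import Data.Fin using (Fin; zero; suc; _≟_)
open import Data.Fin.Subset using (Subset; Side; inside; outside; _∈_)
open import Data.Vec using (lookup)
open import Data.Bool using (Bool; true; false; if_then_else_; _∨_)
open import Data.Product using (_×_; _,_)
open import Data.Sum using (_⊎_)
open import Relation.Nullary using (¬_)
open import Relation.Nullary.Decidable using (⌊_⌋)
open import Relation.Binary.PropositionalEquality using (_≡_)
open import Data.Rational using (ℚ; 0ℚ; _+_; _-_; _*_; _≤_; _<_)

sumFin : (k : ℕ) → (Fin k → ℚ) → ℚ
sumFin zero    f = 0ℚ
sumFin (suc k) f = f zero + sumFin k (λ i → f (suc i))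

sel : Side → ℚ → ℚ
sel inside  q = q
sel outside q = 0ℚ

sumOver : {k : ℕ} → Subset k → (Fin k → ℚ) → ℚ
sumOver {k} A f = sumFin k (λ i → sel (lookup A i) (f i))

record Graph (n m : ℕ) : Set where
  field
    src : Fin m → Fin n
    tgt : Fin m → Fin n
    loopless : ∀ e → ¬ (src e ≡ tgt e)
    noParallel : ∀ e f →
      ((src e ≡ src f × tgt e ≡ tgt f) ⊎ (src e ≡ tgt f × tgt e ≡ src f)) → e ≡ f

module _ {n m : ℕ} (G : Graph n m) where
  open Graph G

  incident : Fin m → Fin n → Bool
  incident e v = ⌊ src e ≟ v ⌋ ∨ ⌊ tgt e ≟ v ⌋

  yInc : (Fin m → ℚ) → Subset m → Fin n → ℚ
  yInc y F' v = sumOver F' (λ e → if incident e v then y e else 0ℚ)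

  yAt : (Fin m → ℚ) → Fin n → ℚ
  yAt y v = sumFin m (λ e → if incident e v then y e else 0ℚ)

  IsFracMatching : (Fin n → ℚ) → (Fin m → ℚ) → Set
  IsFracMatching w y = (∀ e → 0ℚ ≤ y e) × (∀ v → yAt y v ≤ w v)

  slack : (Fin n → ℚ) → (Fin m → ℚ) → Fin n → ℚ
  slack w y v = w v - yAt y v

  IsVertexCover : Subset n → Set
  IsVertexCover S = ∀ e → src e ∈ S ⊎ tgt e ∈ S

  IsMinVertexCover : (Fin n → ℚ) → Subset n → Set
  IsMinVertexCover w S =
    IsVertexCover S × (∀ T → IsVertexCover T → sumOver S w ≤ sumOver T w)

  IsApproxVertexCover : ℚ → (Fin n → ℚ) → Subset n → Set
  IsApproxVertexCover α w S =
    IsVertexCover S × (∀ T → IsVertexCover T → sumOver S w ≤ α * sumOver T w)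

  w′ : (Fin n → ℚ) → (Fin m → ℚ) → Subset n → Subset m → Fin n → ℚ
  w′ w y X F v = w v - sel (lookup X v) (slack w y v) - yInc y F v

{-# OPTIONS --safe #-}
-- Split w = w′ + s·[X] + q with q(v) = y(E(v) ∩ F). Summing q over a node set A counts
-- every edge of F once per endpoint in A: at most 2·y(F) for any A, at least y(F) when A
-- is a vertex cover. Hence w(S) ≤ w′(S) + s(X) + 2·y(F) and w′(S*) + y(F) ≤ w(S*), and
-- w′(S) ≤ α·w′(S*) ≤ α·w(S*) − α·y(F) ≤ α·w(S*) − y(F) since α ≥ 1.
module Submission where

open import Defs
open import Data.Nat using (ℕ; zero; suc)
open import Data.Fin using (Fin; zero; suc; _≟_)
open import Data.Fin.Subset using (Subset; _∈_; inside; outside)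
open import Data.Rational using (ℚ; 0ℚ; 1ℚ; _+_; _*_; _≤_; _<_; NonNegative; nonNegative)
open import Data.Rational.Properties
  using (≤-refl; ≤-trans; ≤-reflexive; <⇒≤; +-mono-≤; +-monoˡ-≤; +-monoʳ-≤; +-identityˡ; +-identityʳ;
         *-identityˡ; *-distribˡ-+; nonNegative⁻¹; *-monoˡ-≤-nonNeg; *-monoʳ-≤-nonNeg; module ≤-Reasoning)
open import Data.Rational.Solver using (module +-*-Solver)
open import Data.Bool using (true; false; if_then_else_; _∨_)
open import Data.Bool.Properties using (∨-zeroʳ)
open import Data.Product using (_,_)
open import Data.Sum using (_⊎_; inj₁; inj₂)
open import Data.Vec using (lookup)
open import Data.Vec.Properties using (lookup⇒[]=; []=⇒lookup)
open import Relation.Nullary using (yes; no)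
open import Relation.Nullary.Decidable using (⌊_⌋; isYes≗does; dec-true)
open import Relation.Binary.PropositionalEquality
  using (_≡_; refl; sym; trans; cong; cong₂; subst; module ≡-Reasoning)

open +-*-Solver using (solve; _:+_; _:-_; _:=_)

private
  variable
    k l : ℕ

sumFin-cong : ∀ k {f g : Fin k → ℚ} → (∀ i → f i ≡ g i) → sumFin k f ≡ sumFin k g
sumFin-cong zero    f≡g = refl
sumFin-cong (suc k) f≡g = cong₂ _+_ (f≡g zero) (sumFin-cong k (λ i → f≡g (suc i)))

sumFin-mono : ∀ k {f g : Fin k → ℚ} → (∀ i → f i ≤ g i) → sumFin k f ≤ sumFin k g
sumFin-mono zero    f≤g = ≤-refl
sumFin-mono (suc k) f≤g = +-mono-≤ (f≤g zero) (sumFin-mono k (λ i → f≤g (suc i)))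

sumFin-zero : ∀ k → sumFin k (λ _ → 0ℚ) ≡ 0ℚ
sumFin-zero zero    = refl
sumFin-zero (suc k) = trans (cong (0ℚ +_) (sumFin-zero k)) (+-identityʳ 0ℚ)

sumFin-+ : ∀ k (f g : Fin k → ℚ) → sumFin k (λ i → f i + g i) ≡ sumFin k f + sumFin k g
sumFin-+ zero    f g = sym (+-identityʳ 0ℚ)
sumFin-+ (suc k) f g = trans (cong (f zero + g zero +_) (sumFin-+ k (λ i → f (suc i)) (λ i → g (suc i))))
  (solve 4 (λ a b c d → (a :+ b) :+ (c :+ d) := (a :+ c) :+ (b :+ d)) refl (f zero) (g zero) _ _)

sumFin-comm : ∀ k l (h : Fin k → Fin l → ℚ) →
  sumFin k (λ i → sumFin l (h i)) ≡ sumFin l (λ j → sumFin k (λ i → h i j))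
sumFin-comm zero    l h = sym (sumFin-zero l)
sumFin-comm (suc k) l h = trans (cong (sumFin l (h zero) +_) (sumFin-comm k l (λ i → h (suc i))))
  (sym (sumFin-+ l (h zero) (λ j → sumFin k (λ i → h (suc i) j))))

sumFin-nonNeg : ∀ k {f : Fin k → ℚ} → (∀ i → 0ℚ ≤ f i) → 0ℚ ≤ sumFin k f
sumFin-nonNeg k {f} f≥0 = subst (_≤ sumFin k f) (sumFin-zero k) (sumFin-mono k f≥0)

term≤sumFin : ∀ k {f : Fin k → ℚ} → (∀ i → 0ℚ ≤ f i) → ∀ i → f i ≤ sumFin k f
term≤sumFin (suc k) {f} f≥0 zero =
  subst (_≤ sumFin (suc k) f) (+-identityʳ (f zero))
    (+-monoʳ-≤ (f zero) (sumFin-nonNeg k (λ i → f≥0 (suc i))))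
term≤sumFin (suc k) {f} f≥0 (suc i) =
  subst (_≤ sumFin (suc k) f) (+-identityˡ (f (suc i)))
    (+-mono-≤ (f≥0 zero) (term≤sumFin k (λ i → f≥0 (suc i)) i))

sumFin-indicator : ∀ k (a : Fin k) c → sumFin k (λ i → if ⌊ a ≟ i ⌋ then c else 0ℚ) ≡ c
sumFin-indicator (suc k) zero    c = trans (cong (c +_) (sumFin-zero k)) (+-identityʳ c)
sumFin-indicator (suc k) (suc a) c =
  trans (+-identityˡ _) (trans (sumFin-cong k suc-≟) (sumFin-indicator k a c))
  where
  suc-≟ : ∀ i → (if ⌊ suc a ≟ suc i ⌋ then c else 0ℚ) ≡ (if ⌊ a ≟ i ⌋ then c else 0ℚ)
  suc-≟ i with a ≟ i
  ... | yes _ = refl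
  ... | no  _ = refl

⌊≟⌋-refl : (i : Fin k) → ⌊ i ≟ i ⌋ ≡ true
⌊≟⌋-refl i = trans (isYes≗does (i ≟ i)) (dec-true (i ≟ i) refl)

-- sumOver A f is definitionally sumFin k (restrict A f); the proofs below rely on this silently.
restrict : Subset k → (Fin k → ℚ) → Fin k → ℚ
restrict A f i = sel (lookup A i) (f i)

sel-+ : ∀ s p q → sel s (p + q) ≡ sel s p + sel s q
sel-+ inside  p q = refl
sel-+ outside p q = sym (+-identityʳ 0ℚ)

sel-comm : ∀ s t p → sel s (sel t p) ≡ sel t (sel s p)
sel-comm inside  inside  p = refl
sel-comm inside  outside p = refl
sel-comm outside inside  p = refl
sel-comm outside outside p = refl

sel-sumFin : ∀ s k (f : Fin k → ℚ) → sel s (sumFin k f) ≡ sumFin k (λ i → sel s (f i))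
sel-sumFin inside  k f = refl
sel-sumFin outside k f = sym (sumFin-zero k)

sel-mono : ∀ s {p q} → p ≤ q → sel s p ≤ sel s q
sel-mono inside  p≤q = p≤q
sel-mono outside p≤q = ≤-refl

restrict-nonNeg : {A : Subset k} {f : Fin k → ℚ} → (∀ i → i ∈ A → 0ℚ ≤ f i) → ∀ i → 0ℚ ≤ restrict A f i
restrict-nonNeg {A = A} f≥0 i with lookup A i in eq
... | inside  = f≥0 i (lookup⇒[]= i A eq)
... | outside = ≤-refl

restrict-≤ : (A : Subset k) {f : Fin k → ℚ} → (∀ i → 0ℚ ≤ f i) → ∀ i → restrict A f i ≤ f i
restrict-≤ A f≥0 i with lookup A i
... | inside  = ≤-refl
... | outside = f≥0 i

restrict-∈ : {A : Subset k} (f : Fin k → ℚ) {i : Fin k} → i ∈ A → restrict A f i ≡ f i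
restrict-∈ {A = A} f {i} i∈A rewrite []=⇒lookup i∈A = refl

sumOver-cong : (A : Subset k) {f g : Fin k → ℚ} → (∀ i → f i ≡ g i) → sumOver A f ≡ sumOver A g
sumOver-cong {k} A f≡g = sumFin-cong k (λ i → cong (sel (lookup A i)) (f≡g i))

sumOver-+ : (A : Subset k) (f g : Fin k → ℚ) → sumOver A (λ i → f i + g i) ≡ sumOver A f + sumOver A g
sumOver-+ {k} A f g =
  trans (sumFin-cong k (λ i → sel-+ (lookup A i) (f i) (g i))) (sumFin-+ k (restrict A f) (restrict A g))

sumOver-mono : (A : Subset k) {f g : Fin k → ℚ} → (∀ i → f i ≤ g i) → sumOver A f ≤ sumOver A g
sumOver-mono {k} A f≤g = sumFin-mono k (λ i → sel-mono (lookup A i) (f≤g i))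

sumOver-nonNeg : (A : Subset k) {f : Fin k → ℚ} → (∀ i → 0ℚ ≤ f i) → 0ℚ ≤ sumOver A f
sumOver-nonNeg {k} A f≥0 = sumFin-nonNeg k (restrict-nonNeg {A = A} (λ i _ → f≥0 i))

sumOver≤sumFin : (A : Subset k) {f : Fin k → ℚ} → (∀ i → 0ℚ ≤ f i) → sumOver A f ≤ sumFin k f
sumOver≤sumFin {k} A f≥0 = sumFin-mono k (restrict-≤ A f≥0)

∈⇒≤sumOver : {A : Subset k} {f : Fin k → ℚ} → (∀ i → 0ℚ ≤ f i) → ∀ {i} → i ∈ A → f i ≤ sumOver A f
∈⇒≤sumOver {k} {A} {f} f≥0 {i} i∈A =
  subst (_≤ sumOver A f) (restrict-∈ f i∈A) (term≤sumFin k (restrict-nonNeg {A = A} (λ j _ → f≥0 j)) i)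

sumOver-comm : (A : Subset k) (B : Subset l) (h : Fin k → Fin l → ℚ) →
  sumOver A (λ i → sumOver B (h i)) ≡ sumOver B (λ j → sumOver A (λ i → h i j))
sumOver-comm {k} {l} A B h = begin
  sumFin k (λ i → sel (lookup A i) (sumFin l (λ j → sel (lookup B j) (h i j))))
    ≡⟨ sumFin-cong k (λ i → sel-sumFin (lookup A i) l _) ⟩
  sumFin k (λ i → sumFin l (λ j → sel (lookup A i) (sel (lookup B j) (h i j))))
    ≡⟨ sumFin-comm k l _ ⟩
  sumFin l (λ j → sumFin k (λ i → sel (lookup A i) (sel (lookup B j) (h i j))))
    ≡⟨ sumFin-cong l (λ j → sumFin-cong k (λ i → sel-comm (lookup A i) (lookup B j) (h i j))) ⟩
  sumFin l (λ j → sumFin k (λ i → sel (lookup B j) (sel (lookup A i) (h i j))))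
    ≡⟨ sumFin-cong l (λ j → sel-sumFin (lookup B j) k _) ⟨
  sumFin l (λ j → sel (lookup B j) (sumFin k (λ i → sel (lookup A i) (h i j))))
    ∎
  where open ≡-Reasoning

if-nonNeg : ∀ b {c} → 0ℚ ≤ c → 0ℚ ≤ (if b then c else 0ℚ)
if-nonNeg true  c≥0 = c≥0
if-nonNeg false c≥0 = ≤-refl

if-∨≤ : ∀ a b {c} → 0ℚ ≤ c → (if a ∨ b then c else 0ℚ) ≤ (if a then c else 0ℚ) + (if b then c else 0ℚ)
if-∨≤ true  b {c} c≥0 = subst (_≤ c + (if b then c else 0ℚ)) (+-identityʳ c) (+-monoʳ-≤ c (if-nonNeg b c≥0))
if-∨≤ false b {c} c≥0 = ≤-reflexive (sym (+-identityˡ (if b then c else 0ℚ)))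

module _ {n m : ℕ} (G : Graph n m) where
  open Graph G

  incident-src : ∀ e → incident G e (src e) ≡ true
  incident-src e = cong (_∨ ⌊ tgt e ≟ src e ⌋) (⌊≟⌋-refl (src e))

  incident-tgt : ∀ e → incident G e (tgt e) ≡ true
  incident-tgt e = trans (cong (⌊ src e ≟ tgt e ⌋ ∨_) (⌊≟⌋-refl (tgt e))) (∨-zeroʳ ⌊ src e ≟ tgt e ⌋)

  sumOver-incident≤ : (A : Subset n) (e : Fin m) {c : ℚ} → 0ℚ ≤ c →
    sumOver A (λ v → if incident G e v then c else 0ℚ) ≤ c + c
  sumOver-incident≤ A e {c} c≥0 = begin
    sumOver A (λ v → if incident G e v then c else 0ℚ)
      ≤⟨ sumOver≤sumFin A (λ v → if-nonNeg (incident G e v) c≥0) ⟩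
    sumFin n (λ v → if incident G e v then c else 0ℚ)
      ≤⟨ sumFin-mono n (λ v → if-∨≤ ⌊ src e ≟ v ⌋ ⌊ tgt e ≟ v ⌋ c≥0) ⟩
    sumFin n (λ v → (if ⌊ src e ≟ v ⌋ then c else 0ℚ) + (if ⌊ tgt e ≟ v ⌋ then c else 0ℚ))
      ≡⟨ sumFin-+ n _ _ ⟩
    sumFin n (λ v → if ⌊ src e ≟ v ⌋ then c else 0ℚ) + sumFin n (λ v → if ⌊ tgt e ≟ v ⌋ then c else 0ℚ)
      ≡⟨ cong₂ _+_ (sumFin-indicator n (src e) c) (sumFin-indicator n (tgt e) c) ⟩
    c + c ∎
    where open ≤-Reasoning

  incident∈⇒≤sumOver : (A : Subset n) (e : Fin m) {c : ℚ} → 0ℚ ≤ c →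
    ∀ {v} → incident G e v ≡ true → v ∈ A → c ≤ sumOver A (λ u → if incident G e u then c else 0ℚ)
  incident∈⇒≤sumOver A e {c} c≥0 incident≡true v∈A =
    subst (_≤ sumOver A (λ u → if incident G e u then c else 0ℚ))
      (cong (λ b → if b then c else 0ℚ) incident≡true)
      (∈⇒≤sumOver (λ u → if-nonNeg (incident G e u) c≥0) v∈A)

  covered⇒≤sumOver-incident : (A : Subset n) (e : Fin m) {c : ℚ} → 0ℚ ≤ c →
    src e ∈ A ⊎ tgt e ∈ A → c ≤ sumOver A (λ v → if incident G e v then c else 0ℚ)
  covered⇒≤sumOver-incident A e c≥0 (inj₁ src∈A) = incident∈⇒≤sumOver A e c≥0 (incident-src e) src∈A
  covered⇒≤sumOver-incident A e c≥0 (inj₂ tgt∈A) = incident∈⇒≤sumOver A e c≥0 (incident-tgt e) tgt∈A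

  sumOver-yInc : (A : Subset n) (y : Fin m → ℚ) (F : Subset m) →
    sumOver A (yInc G y F) ≡ sumOver F (λ e → sumOver A (λ v → if incident G e v then y e else 0ℚ))
  sumOver-yInc A y F = sumOver-comm A F (λ v e → if incident G e v then y e else 0ℚ)

  sumOver-yInc≤ : (A : Subset n) {y : Fin m → ℚ} (F : Subset m) → (∀ e → 0ℚ ≤ y e) →
    sumOver A (yInc G y F) ≤ sumOver F y + sumOver F y
  sumOver-yInc≤ A {y} F y≥0 = begin
    sumOver A (yInc G y F)
      ≡⟨ sumOver-yInc A y F ⟩
    sumOver F (λ e → sumOver A (λ v → if incident G e v then y e else 0ℚ))
      ≤⟨ sumOver-mono F (λ e → sumOver-incident≤ A e (y≥0 e)) ⟩
    sumOver F (λ e → y e + y e)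
      ≡⟨ sumOver-+ F y y ⟩
    sumOver F y + sumOver F y ∎
    where open ≤-Reasoning

  cover⇒≤sumOver-yInc : {A : Subset n} {y : Fin m → ℚ} (F : Subset m) →
    IsVertexCover G A → (∀ e → 0ℚ ≤ y e) → sumOver F y ≤ sumOver A (yInc G y F)
  cover⇒≤sumOver-yInc {A} {y} F cover y≥0 = begin
    sumOver F y
      ≤⟨ sumOver-mono F (λ e → covered⇒≤sumOver-incident A e (y≥0 e) (cover e)) ⟩
    sumOver F (λ e → sumOver A (λ v → if incident G e v then y e else 0ℚ))
      ≡⟨ sumOver-yInc A y F ⟨
    sumOver A (yInc G y F) ∎
    where open ≤-Reasoning

  module _ (w : Fin n → ℚ) (y : Fin m → ℚ) (X : Subset n) (F : Subset m) where

    sumOver-w≡w′+slack+yInc : (A : Subset n) →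
      sumOver A w ≡ sumOver A (w′ G w y X F) + sumOver A (restrict X (slack G w y)) + sumOver A (yInc G y F)
    sumOver-w≡w′+slack+yInc A = begin
      sumOver A w
        ≡⟨ sumOver-cong A (λ v → solve 3 (λ a b c → a := (a :- b :- c) :+ b :+ c) refl (w v) (p v) (q v)) ⟩
      sumOver A (λ v → w′ G w y X F v + p v + q v)
        ≡⟨ sumOver-+ A (λ v → w′ G w y X F v + p v) q ⟩
      sumOver A (λ v → w′ G w y X F v + p v) + sumOver A q
        ≡⟨ cong (_+ sumOver A q) (sumOver-+ A (w′ G w y X F) p) ⟩
      sumOver A (w′ G w y X F) + sumOver A p + sumOver A q ∎
      where
      open ≡-Reasoning
      p q : Fin n → ℚ
      p = restrict X (slack G w y)
      q = yInc G y F

    module _ (slack≥0 : ∀ v → v ∈ X → 0ℚ ≤ slack G w y v) (y≥0 : ∀ e → 0ℚ ≤ y e) where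

      sumOver-w≤w′+slack+2y : (A : Subset n) →
        sumOver A w ≤ sumOver A (w′ G w y X F) + sumOver X (slack G w y) + (sumOver F y + sumOver F y)
      sumOver-w≤w′+slack+2y A = begin
        sumOver A w
          ≡⟨ sumOver-w≡w′+slack+yInc A ⟩
        sumOver A (w′ G w y X F) + sumOver A (restrict X (slack G w y)) + sumOver A (yInc G y F)
          ≤⟨ +-mono-≤ (+-monoʳ-≤ (sumOver A (w′ G w y X F)) (sumOver≤sumFin A (restrict-nonNeg slack≥0)))
                      (sumOver-yInc≤ A F y≥0) ⟩
        sumOver A (w′ G w y X F) + sumOver X (slack G w y) + (sumOver F y + sumOver F y) ∎
        where open ≤-Reasoning

      cover⇒sumOver-w′+y≤w : {A : Subset n} → IsVertexCover G A →
        sumOver A (w′ G w y X F) + sumOver F y ≤ sumOver A w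
      cover⇒sumOver-w′+y≤w {A} cover = begin
        sumOver A (w′ G w y X F) + sumOver F y
          ≡⟨ cong (_+ sumOver F y) (+-identityʳ (sumOver A (w′ G w y X F))) ⟨
        sumOver A (w′ G w y X F) + 0ℚ + sumOver F y
          ≤⟨ +-mono-≤ (+-monoʳ-≤ (sumOver A (w′ G w y X F)) (sumOver-nonNeg A (restrict-nonNeg slack≥0)))
                      (cover⇒≤sumOver-yInc F cover y≥0) ⟩
        sumOver A (w′ G w y X F) + sumOver A (restrict X (slack G w y)) + sumOver A (yInc G y F)
          ≡⟨ sumOver-w≡w′+slack+yInc A ⟨
        sumOver A w ∎
        where open ≤-Reasoning

lemma3p4 : {n m : ℕ} (G : Graph n m) (w : Fin n → ℚ) (y : Fin m → ℚ)
    (X : Subset n) (F : Subset m) (S* S : Subset n) (α : ℚ) →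
    (∀ v → 0ℚ ≤ w v) →
    IsFracMatching G w y →
    (∀ v → v ∈ X → 0ℚ < slack G w y v) →
    (∀ e → e ∈ F → 0ℚ < y e) →
    IsMinVertexCover G w S* →
    1ℚ ≤ α →
    IsApproxVertexCover G α (w′ G w y X F) S →
    sumOver S w ≤ α * sumOver S* w + sumOver X (slack G w y) + sumOver F y
lemma3p4 {n} G w y X F S* S α _ (y≥0 , _) slack>0 _ (S*-cover , _) 1≤α (_ , S-approx) = begin
  sumOver S w
    ≤⟨ sumOver-w≤w′+slack+2y G w y X F slack≥0 y≥0 S ⟩
  sumOver S w′ₓ + sX + (Y + Y)
    ≤⟨ +-monoˡ-≤ (Y + Y) (+-monoˡ-≤ sX (S-approx S* S*-cover)) ⟩
  α * sumOver S* w′ₓ + sX + (Y + Y)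
    ≡⟨ solve 3 (λ a s t → a :+ s :+ (t :+ t) := a :+ t :+ s :+ t) refl (α * sumOver S* w′ₓ) sX Y ⟩
  α * sumOver S* w′ₓ + Y + sX + Y
    ≤⟨ +-monoˡ-≤ Y (+-monoˡ-≤ sX (+-monoʳ-≤ (α * sumOver S* w′ₓ) Y≤αY)) ⟩
  α * sumOver S* w′ₓ + α * Y + sX + Y
    ≡⟨ cong (λ t → t + sX + Y) (*-distribˡ-+ α (sumOver S* w′ₓ) Y) ⟨
  α * (sumOver S* w′ₓ + Y) + sX + Y
    ≤⟨ +-monoˡ-≤ Y (+-monoˡ-≤ sX (*-monoˡ-≤-nonNeg α {{α-nonNeg}}
         (cover⇒sumOver-w′+y≤w G w y X F slack≥0 y≥0 S*-cover))) ⟩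
  α * sumOver S* w + sX + Y ∎
  where
  open ≤-Reasoning
  w′ₓ : Fin n → ℚ
  w′ₓ = w′ G w y X F
  sX Y : ℚ
  sX = sumOver X (slack G w y)
  Y = sumOver F y
  slack≥0 : ∀ v → v ∈ X → 0ℚ ≤ slack G w y v
  slack≥0 v v∈X = <⇒≤ (slack>0 v v∈X)
  Y≥0 : 0ℚ ≤ Y
  Y≥0 = sumOver-nonNeg F y≥0
  Y≤αY : Y ≤ α * Y
  Y≤αY = subst (_≤ α * Y) (*-identityˡ Y) (*-monoʳ-≤-nonNeg Y {{nonNegative Y≥0}} 1≤α)
  α-nonNeg : NonNegative α
  α-nonNeg = nonNegative (≤-trans (nonNegative⁻¹ 1ℚ) 1≤α)
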